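{- Fix $n\ge 0$ and let $r_k,s_k,t_k$ be elements of a commutative ring, with the conventions $r_{ -1}=t_0=0$. Let $L_n$ be the $(n+2)\times(n+2)$ matrix with rows and columns indexed by $0,\dots,n+1$ whose nonzero entries are: $(L_n)_{0,0}=1$, and for $1\le i\le n+1$, $(L_n)_{i,i}=r_{i-1}$, $(L_n)_{i,i-1}=s_{i-1}$, and (for $i\ge 2$) $(L_n)_{i,i-2}=t_{i-1}$. Equip the digraph $D^{L_n}$ with any one of the weight functions of Types 1–5 below (Type 5 being allowed only when there are ring elements $b_k,c_k$ with $r_k=1$, $s_k=b_k+c_k$, $t_{k+1}=b_{k+1}c_k$ for all $k\ge0$). Then for all $0\le i,j\le n+1$, $$(L_n)_{i,j}=GF\big(P_{n+1-i}^{(n)},P_{n+1-j}^{(n+1)}\big).$$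
   Context: The digraph $D^{L_n}$ has vertices $P_i^{(n)}=(2n,i)$, $Q_i^{(n)}=(2n+1,i)$, $P_i^{(n+1)}=(2n+2,i)$ for $0\le i\le n+1$, and arcs: horizontal arcs $P_k^{(n)}\to Q_k^{(n)}$ and $Q_k^{(n)}\to P_k^{(n+1)}$ for $0\le k\le n+1$; diagonal arcs $P_k^{(n)}\to Q_{k+1}^{(n)}$ and $Q_k^{(n)}\to P_{k+1}^{(n+1)}$ for $0\le k\le n$; super diagonal arcs $P_k^{(n)}\to P_{k+1}^{(n+1)}$ for $0\le k\le n$. For vertices $u,v$, $GF(u,v)$ is the sum over all directed paths from $u$ to $v$ of the product of the weights of their arcs, with $GF(u,u)=1$. Weight functions (in each case $0\le k\le n$ unless stated; all arcs not listed get weight $1$): Type 1: $P_k^{(n)}\to Q_k^{(n)}$ gets $r_{n-k}$; $P_k^{(n)}\to Q_{k+1}^{(n)}$ gets $t_{n-k}$; $P_k^{(n)}\to P_{k+1}^{(n+1)}$ gets $s_{n-k}-r_{n-k}-t_{n-k}$. Type 2: $Q_k^{(n)}\to P_k^{(n+1)}$ gets $r_{n-k}$; $Q_k^{(n)}\to P_{k+1}^{(n+1)}$ gets $t_{n-k+1}$; $P_k^{(n)}\to P_{k+1}^{(n+1)}$ gets $s_{n-k}-r_{n-k-1}-t_{n-k+1}$; $P_n^{(n)}\to Q_{n+1}^{(n)}$ gets $0$. Type 3: $Q_k^{(n)}\to P_k^{(n+1)}$ gets $r_{n-k}$; $P_k^{(n)}\to Q_{k+1}^{(n)}$ gets $t_{n-k}$;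 $P_k^{(n)}\to P_{k+1}^{(n+1)}$ gets $s_{n-k}-r_{n-k-1}t_{n-k}-1$. Type 4: $P_k^{(n)}\to Q_k^{(n)}$ gets $r_{n-k}$; $Q_k^{(n)}\to P_{k+1}^{(n+1)}$ gets $t_{n-k+1}$; $P_k^{(n)}\to P_{k+1}^{(n+1)}$ gets $s_{n-k}-r_{n-k}t_{n-k+1}-1$ for $0\le k\le n-1$; $P_n^{(n)}\to P_{n+1}^{(n+1)}$ gets $s_0-r_0t_1$; $P_n^{(n)}\to Q_{n+1}^{(n)}$ gets $0$. Type 5: $P_k^{(n)}\to Q_{k+1}^{(n)}$ gets $b_{n-k}$; $Q_k^{(n)}\to P_{k+1}^{(n+1)}$ gets $c_{n-k}$; $P_k^{(n)}\to P_{k+1}^{(n+1)}$ gets $0$. -}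

module Defs where

open import Level using (Level; _⊔_)
open import Algebra.Bundles using (CommutativeRing)
open import Data.Nat using (ℕ; zero; suc; _∸_; _≡ᵇ_; _≤ᵇ_; _<ᵇ_)
open import Data.Bool using (if_then_else_)

module Setup {c ℓ : Level} (R : CommutativeRing c ℓ) where
  open CommutativeRing R

  -- Conventions: given sequences r, t : ℕ → R,
  --   rm j  denotes r_{j-1}, so rm 0 = r_{-1} = 0;
  --   tc j  denotes t_j with the convention t_0 = 0.
  rm : (ℕ → Carrier) → ℕ → Carrier
  rm r zero    = 0#
  rm r (suc j) = r j

  tc : (ℕ → Carrier) → ℕ → Carrier
  tc t zero    = 0#
  tc t (suc j) = t (suc j)

  -- The matrix L_n, entries indexed by i j (only 0 ≤ i,j ≤ n+1 are used;
  -- the entries do not depend on n).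
  Lmat : (r s t : ℕ → Carrier) → ℕ → ℕ → Carrier
  Lmat r s t zero    zero    = 1#
  Lmat r s t zero    (suc j) = 0#
  Lmat r s t (suc i) j =
    if j ≡ᵇ suc i then r i
    else if j ≡ᵇ i then s i
    else if suc j ≡ᵇ i then tc t i
    else 0#

  -- Arc weights of D^{L_n}, by arc kind, indexed by the source row k:
  --   h1 k : P_k^(n) → Q_k^(n)        d1 k : P_k^(n) → Q_{k+1}^(n)
  --   h2 k : Q_k^(n) → P_k^(n+1)      d2 k : Q_k^(n) → P_{k+1}^(n+1)
  --   sd k : P_k^(n) → P_{k+1}^(n+1)  (super diagonal)
  record Weights : Set c where
    field
      h1 d1 h2 d2 sd : ℕ → Carrier

  data WeightType (r s t : ℕ → Carrier) : Set (c ⊔ ℓ) where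
    type1 type2 type3 type4 : WeightType r s t
    type5 : (b c′ : ℕ → Carrier) →
            (∀ k → r k ≈ 1#) →
            (∀ k → s k ≈ b k + c′ k) →
            (∀ k → t (suc k) ≈ b (suc k) * c′ k) →
            WeightType r s t

  -- "for 0 ≤ k ≤ n the weight is x; otherwise (unlisted arc) weight 1"
  upto : ℕ → ℕ → Carrier → Carrier
  upto n k x = if k ≤ᵇ n then x else 1#

  weights : (n : ℕ) (r s t : ℕ → Carrier) → WeightType r s t → Weights
  weights n r s t type1 = record
    { h1 = λ k → upto n k (r (n ∸ k))
    ; d1 = λ k → upto n k (tc t (n ∸ k))
    ; h2 = λ k → 1#
    ; d2 = λ k → 1#
    ; sd = λ k → upto n k (s (n ∸ k) - r (n ∸ k) - tc t (n ∸ k))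
    }
  weights n r s t type2 = record
    { h1 = λ k → 1#
    ; d1 = λ k → if k ≡ᵇ n then 0# else 1#
    ; h2 = λ k → upto n k (r (n ∸ k))
    ; d2 = λ k → upto n k (tc t (suc (n ∸ k)))
    ; sd = λ k → upto n k (s (n ∸ k) - rm r (n ∸ k) - tc t (suc (n ∸ k)))
    }
  weights n r s t type3 = record
    { h1 = λ k → 1#
    ; d1 = λ k → upto n k (tc t (n ∸ k))
    ; h2 = λ k → upto n k (r (n ∸ k))
    ; d2 = λ k → 1#
    ; sd = λ k → upto n k (s (n ∸ k) - rm r (n ∸ k) * tc t (n ∸ k) - 1#)
    }
  weights n r s t type4 = record
    { h1 = λ k → upto n k (r (n ∸ k))
    ; d1 = λ k → if k ≡ᵇ n then 0# else 1#
    ; h2 = λ k → 1#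
    ; d2 = λ k → upto n k (tc t (suc (n ∸ k)))
    ; sd = λ k → if k <ᵇ n then s (n ∸ k) - r (n ∸ k) * tc t (suc (n ∸ k)) - 1#
                 else upto n k (s 0 - r 0 * tc t 1)
    }
  weights n r s t (type5 b c′ _ _ _) = record
    { h1 = λ k → 1#
    ; d1 = λ k → upto n k (b (n ∸ k))
    ; h2 = λ k → 1#
    ; d2 = λ k → upto n k (c′ (n ∸ k))
    ; sd = λ k → upto n k 0#
    }

  -- Rows range over 0 … n+1; the arcs P_k → Q_{k+1}, Q_k → P_{k+1},
  -- P_k → P_{k+1} exist exactly when the target row k+1 ≤ n+1.
  module _ (w : Weights) where
    open Weights w
    wPQ : ℕ → ℕ → Carrier
    wPQ a m = if m ≡ᵇ a then h1 a else if m ≡ᵇ suc a then d1 a else 0#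
    wQP : ℕ → ℕ → Carrier
    wQP m b = if b ≡ᵇ m then h2 m else if b ≡ᵇ suc m then d2 m else 0#
    wPP : ℕ → ℕ → Carrier
    wPP a b = if b ≡ᵇ suc a then sd a else 0#

  Σ< : ℕ → (ℕ → Carrier) → Carrier
  Σ< zero    f = 0#
  Σ< (suc N) f = Σ< N f + f N

  -- GF(P_a^(n), P_b^(n+1)) in D^{L_n}: a directed path from column 2n to
  -- column 2n+2 is either a super-diagonal arc or P_a → Q_m → P_b for a
  -- unique middle vertex Q_m^(n), 0 ≤ m ≤ n+1.
  GF : (n : ℕ) → Weights → ℕ → ℕ → Carrier
  GF n w a b = Σ< (suc (suc n)) (λ m → wPQ w a m * wQP w m b) + wPP w a b

{-# OPTIONS --safe #-}
module Submission where

-- A path from column 2n to column 2n+2 of D^{L_n} is either a super-diagonal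
-- arc P_a → P_{a+1} or runs through a single Q_m with m ∈ {a, a+1}.  Hence
-- GF(P_a, P_b) vanishes unless b ∈ {a, a+1, a+2}, where it equals
-- h1 a · h2 a,  h1 a · d2 a + d1 a · h2 (a+1) + sd a  and  d1 a · d2 (a+1).
-- Under the reflection i = n+1−a these are the diagonal, subdiagonal and
-- second subdiagonal of L_n, so the theorem reduces to four local identities
-- between arc weights, which each weight type is designed to satisfy.

open import Defs
open import Level using (Level)
open import Algebra.Bundles using (CommutativeRing)
open import Data.Bool using (true; false; if_then_else_)
open import Data.Nat
  using (ℕ; zero; suc; _∸_; _≤_; _<_; _≡ᵇ_; _≤ᵇ_; _<ᵇ_; z≤n; s≤s; s≤s⁻¹)
open import Data.Nat.Properties
  using ( _≟_; _≤?_; _<?_; <⇒≱; <⇒≢; >⇒≢; <⇒≤; <-irrefl; n<1+n; 1+n≢n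
        ; m<n⇒m<1+n; m≤n⇒m≤1+n; m≤n⇒m<n∨m≡n; n∸n≡0; m∸n≤m; m∸[m∸n]≡n
        ; +-∸-assoc; ∸-cancelˡ-≡ )
open import Data.Fin using (Fin; toℕ)
open import Data.Fin.Properties using (toℕ≤pred[n])
open import Data.Sum using (inj₁; inj₂)
open import Relation.Nullary.Decidable using (yes; no; dec-true; dec-false)
open import Relation.Binary.PropositionalEquality
  using (_≡_; _≢_; refl; sym; trans; cong; subst₂; ≢-sym)

≡ᵇ-refl : ∀ m → (m ≡ᵇ m) ≡ true
≡ᵇ-refl m = dec-true (m ≟ m) refl

≢⇒≡ᵇ≡false : ∀ {m n} → m ≢ n → (m ≡ᵇ n) ≡ false
≢⇒≡ᵇ≡false {m} {n} = dec-false (m ≟ n)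

≤⇒≤ᵇ≡true : ∀ {m n} → m ≤ n → (m ≤ᵇ n) ≡ true
≤⇒≤ᵇ≡true {m} {n} = dec-true (m ≤? n)

>⇒≤ᵇ≡false : ∀ {m n} → n < m → (m ≤ᵇ n) ≡ false
>⇒≤ᵇ≡false {m} {n} n<m = dec-false (m ≤? n) (<⇒≱ n<m)

<⇒<ᵇ≡true : ∀ {m n} → m < n → (m <ᵇ n) ≡ true
<⇒<ᵇ≡true {m} {n} = dec-true (m <? n)

<ᵇ-irrefl : ∀ n → (n <ᵇ n) ≡ false
<ᵇ-irrefl n = dec-false (n <? n) (<-irrefl refl)

n≢1+n : ∀ n → n ≢ suc n
n≢1+n n = <⇒≢ (n<1+n n)

n≢2+n : ∀ n → n ≢ suc (suc n)
n≢2+n n = <⇒≢ (m<n⇒m<1+n (n<1+n n))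

m∸n≡1+[m∸1+n] : ∀ {m n} → n < m → m ∸ n ≡ suc (m ∸ suc n)
m∸n≡1+[m∸1+n] = +-∸-assoc 1

module _ {c ℓ : Level} (R : CommutativeRing c ℓ) where
  open CommutativeRing R
    renaming (refl to ≈-refl; sym to ≈-sym; trans to ≈-trans) hiding (zero)
  open Setup R
  open import Relation.Binary.Reasoning.Setoid setoid

  x+[s-x]≈s : ∀ x s → x + (s - x) ≈ s
  x+[s-x]≈s x s = begin
    x + (s - x)     ≈⟨ +-comm x (s - x) ⟩
    s - x + x       ≈⟨ +-assoc s (- x) x ⟩
    s + (- x + x)   ≈⟨ +-congˡ (-‿inverseˡ x) ⟩
    s + 0#          ≈⟨ +-identityʳ s ⟩
    s               ∎

  x+y+[s-x-y]≈s : ∀ x y s → x + y + (s - x - y) ≈ s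
  x+y+[s-x-y]≈s x y s = begin
    x + y + (s - x - y)     ≈⟨ +-assoc x y (s - x - y) ⟩
    x + (y + (s - x - y))   ≈⟨ +-congˡ (x+[s-x]≈s y (s - x)) ⟩
    x + (s - x)             ≈⟨ x+[s-x]≈s x s ⟩
    s                       ∎

  x+y+[s-y-x]≈s : ∀ x y s → x + y + (s - y - x) ≈ s
  x+y+[s-y-x]≈s x y s = ≈-trans (+-congʳ (+-comm x y)) (x+y+[s-x-y]≈s y x s)

  Σ<-truncate : ∀ {f N M} → N ≤ M → (∀ {m} → N ≤ m → m < M → f m ≈ 0#) →
                Σ< M f ≈ Σ< N f
  Σ<-truncate {M = zero} z≤n _ = ≈-refl
  Σ<-truncate {f} {N} {suc M} N≤1+M vanish with m≤n⇒m<n∨m≡n N≤1+M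
  ... | inj₂ refl       = ≈-refl
  ... | inj₁ (s≤s N≤M) = begin
    Σ< M f + f M  ≈⟨ +-cong (Σ<-truncate N≤M (λ N≤m m<M → vanish N≤m (m<n⇒m<1+n m<M)))
                            (vanish N≤M (n<1+n M)) ⟩
    Σ< N f + 0#   ≈⟨ +-identityʳ _ ⟩
    Σ< N f        ∎

  -- wPQ w is definitionally bidiagonal h1 d1, and wQP w is bidiagonal h2 d2.
  bidiagonal : (ℕ → Carrier) → (ℕ → Carrier) → ℕ → ℕ → Carrier
  bidiagonal x y a m = if m ≡ᵇ a then x a else if m ≡ᵇ suc a then y a else 0#

  bidiagonal-diag : ∀ x y {a} → bidiagonal x y a a ≡ x a
  bidiagonal-diag x y {a} rewrite ≡ᵇ-refl a = refl

  bidiagonal-super : ∀ x y {a} → bidiagonal x y a (suc a) ≡ y a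
  bidiagonal-super x y {a} rewrite ≢⇒≡ᵇ≡false (1+n≢n {a}) | ≡ᵇ-refl a = refl

  bidiagonal-zero : ∀ x y {a m} → m ≢ a → m ≢ suc a → bidiagonal x y a m ≡ 0#
  bidiagonal-zero x y m≢a m≢1+a rewrite ≢⇒≡ᵇ≡false m≢a | ≢⇒≡ᵇ≡false m≢1+a = refl

  module _ (n : ℕ) (w : Weights) where
    open Weights w

    wPP-super : ∀ {a} → wPP w a (suc a) ≡ sd a
    wPP-super {a} rewrite ≡ᵇ-refl a = refl

    wPP-zero : ∀ {a b} → b ≢ suc a → wPP w a b ≡ 0#
    wPP-zero b≢1+a rewrite ≢⇒≡ᵇ≡false b≢1+a = refl

    -- GF n w a b is definitionally Σ< (suc (suc n)) (paths-via a b) + wPP w a b.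
    paths-via : ℕ → ℕ → ℕ → Carrier
    paths-via a b m = wPQ w a m * wQP w m b

    paths-via-zero : ∀ a b {m} → m ≢ a → m ≢ suc a → paths-via a b m ≈ 0#
    paths-via-zero a b m≢a m≢1+a =
      ≈-trans (*-congʳ (reflexive (bidiagonal-zero h1 d1 m≢a m≢1+a))) (zeroˡ _)

    GF-expand : ∀ a b {u v p} → a ≤ n →
                wQP w a b ≡ u → wQP w (suc a) b ≡ v → wPP w a b ≡ p →
                GF n w a b ≈ h1 a * u + d1 a * v + p
    GF-expand a b a≤n refl refl refl = +-congʳ (begin
      Σ< (suc (suc n)) (paths-via a b)
        ≈⟨ Σ<-truncate (s≤s (s≤s a≤n)) (λ 2+a≤m _ →
             paths-via-zero a b (>⇒≢ (<⇒≤ 2+a≤m)) (>⇒≢ 2+a≤m)) ⟩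
      Σ< a (paths-via a b) + paths-via a b a + paths-via a b (suc a)
        ≈⟨ +-congʳ (+-congʳ (Σ<-truncate {f = paths-via a b} z≤n (λ _ m<a →
             paths-via-zero a b (<⇒≢ m<a) (<⇒≢ (m<n⇒m<1+n m<a))))) ⟩
      0# + paths-via a b a + paths-via a b (suc a)
        ≈⟨ +-congʳ (+-identityˡ _) ⟩
      paths-via a b a + paths-via a b (suc a)
        ≈⟨ +-cong (*-congʳ (reflexive (bidiagonal-diag h1 d1)))
                  (*-congʳ (reflexive (bidiagonal-super h1 d1))) ⟩
      h1 a * wQP w a b + d1 a * wQP w (suc a) b ∎)

    GF-expand-top : ∀ b {u p} → wQP w (suc n) b ≡ u → wPP w (suc n) b ≡ p →
                    GF n w (suc n) b ≈ h1 (suc n) * u + p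
    GF-expand-top b refl refl = +-congʳ (begin
      Σ< (suc n) (paths-via (suc n) b) + paths-via (suc n) b (suc n)
        ≈⟨ +-congʳ (Σ<-truncate {f = paths-via (suc n) b} z≤n (λ _ m<1+n →
             paths-via-zero (suc n) b (<⇒≢ m<1+n) (<⇒≢ (m<n⇒m<1+n m<1+n)))) ⟩
      0# + paths-via (suc n) b (suc n)
        ≈⟨ +-identityˡ _ ⟩
      paths-via (suc n) b (suc n)
        ≈⟨ *-congʳ (reflexive (bidiagonal-diag h1 d1)) ⟩
      h1 (suc n) * wQP w (suc n) b ∎)

    GF-diag : ∀ {a} → a ≤ n → GF n w a a ≈ h1 a * h2 a
    GF-diag {a} a≤n = begin
      GF n w a a                    ≈⟨ GF-expand a a a≤n (bidiagonal-diag h2 d2)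
                                         (bidiagonal-zero h2 d2 (n≢1+n a) (n≢2+n a))
                                         (wPP-zero (n≢1+n a)) ⟩
      h1 a * h2 a + d1 a * 0# + 0#  ≈⟨ +-identityʳ _ ⟩
      h1 a * h2 a + d1 a * 0#       ≈⟨ +-congˡ (zeroʳ _) ⟩
      h1 a * h2 a + 0#              ≈⟨ +-identityʳ _ ⟩
      h1 a * h2 a                   ∎

    GF-super : ∀ {a} → a ≤ n → GF n w a (suc a) ≈ h1 a * d2 a + d1 a * h2 (suc a) + sd a
    GF-super {a} a≤n =
      GF-expand a (suc a) a≤n (bidiagonal-super h2 d2) (bidiagonal-diag h2 d2) wPP-super

    GF-super² : ∀ {a} → a ≤ n → GF n w a (suc (suc a)) ≈ d1 a * d2 (suc a)
    GF-super² {a} a≤n = begin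
      GF n w a (suc (suc a))             ≈⟨ GF-expand a (suc (suc a)) a≤n
                                              (bidiagonal-zero h2 d2 (≢-sym (n≢2+n a)) 1+n≢n)
                                              (bidiagonal-super h2 d2) (wPP-zero 1+n≢n) ⟩
      h1 a * 0# + d1 a * d2 (suc a) + 0# ≈⟨ +-identityʳ _ ⟩
      h1 a * 0# + d1 a * d2 (suc a)      ≈⟨ +-congʳ (zeroʳ _) ⟩
      0# + d1 a * d2 (suc a)             ≈⟨ +-identityˡ _ ⟩
      d1 a * d2 (suc a)                  ∎

    GF-far : ∀ {a b} → a ≤ n → b ≢ a → b ≢ suc a → b ≢ suc (suc a) → GF n w a b ≈ 0#
    GF-far {a} {b} a≤n b≢a b≢1+a b≢2+a = begin
      GF n w a b                  ≈⟨ GF-expand a b a≤n (bidiagonal-zero h2 d2 b≢a b≢1+a)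
                                       (bidiagonal-zero h2 d2 b≢1+a b≢2+a) (wPP-zero b≢1+a) ⟩
      h1 a * 0# + d1 a * 0# + 0#  ≈⟨ +-identityʳ _ ⟩
      h1 a * 0# + d1 a * 0#       ≈⟨ +-cong (zeroʳ _) (zeroʳ _) ⟩
      0# + 0#                     ≈⟨ +-identityʳ _ ⟩
      0#                          ∎

    GF-top-diag : GF n w (suc n) (suc n) ≈ h1 (suc n) * h2 (suc n)
    GF-top-diag = ≈-trans
      (GF-expand-top (suc n) (bidiagonal-diag h2 d2) (wPP-zero (n≢1+n (suc n))))
      (+-identityʳ _)

    GF-top-far : ∀ {b} → b ≤ n → GF n w (suc n) b ≈ 0#
    GF-top-far {b} b≤n = begin
      GF n w (suc n) b       ≈⟨ GF-expand-top b (bidiagonal-zero h2 d2 b≢1+n b≢2+n)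
                                                 (wPP-zero b≢2+n) ⟩
      h1 (suc n) * 0# + 0#   ≈⟨ +-identityʳ _ ⟩
      h1 (suc n) * 0#        ≈⟨ zeroʳ _ ⟩
      0#                     ∎
      where
      b≢1+n : b ≢ suc n
      b≢1+n = <⇒≢ (s≤s b≤n)
      b≢2+n : b ≢ suc (suc n)
      b≢2+n = <⇒≢ (m<n⇒m<1+n (s≤s b≤n))

  module _ (r s t : ℕ → Carrier) where

    Lmat-diag : ∀ {i j} → j ≡ suc i → Lmat r s t (suc i) j ≡ r i
    Lmat-diag {i} refl rewrite ≡ᵇ-refl i = refl

    Lmat-sub : ∀ {i j} → j ≡ i → Lmat r s t (suc i) j ≡ s i
    Lmat-sub {i} refl rewrite ≢⇒≡ᵇ≡false (n≢1+n i) | ≡ᵇ-refl i = refl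

    Lmat-subsub : ∀ {i j} → suc j ≡ i → Lmat r s t (suc i) j ≡ tc t i
    Lmat-subsub {j = j} refl
      rewrite ≢⇒≡ᵇ≡false (n≢2+n j) | ≢⇒≡ᵇ≡false (n≢1+n j) | ≡ᵇ-refl j = refl

    Lmat-zero : ∀ {i j} → j ≢ suc i → j ≢ i → suc j ≢ i → Lmat r s t (suc i) j ≡ 0#
    Lmat-zero j≢1+i j≢i 1+j≢i
      rewrite ≢⇒≡ᵇ≡false j≢1+i | ≢⇒≡ᵇ≡false j≢i | ≢⇒≡ᵇ≡false 1+j≢i = refl

  record Realises (n : ℕ) (r s t : ℕ → Carrier) (w : Weights) : Set ℓ where
    open Weights w
    field
      top-corner     : h1 (suc n) * h2 (suc n) ≈ 1#
      diagonal       : ∀ {a} → a ≤ n → h1 a * h2 a ≈ r (n ∸ a)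
      subdiagonal    : ∀ {a} → a ≤ n → h1 a * d2 a + d1 a * h2 (suc a) + sd a ≈ s (n ∸ a)
      subsubdiagonal : ∀ {a} → suc a ≤ n → d1 a * d2 (suc a) ≈ tc t (n ∸ a)

  module _ {n : ℕ} {r s t : ℕ → Carrier} {w : Weights} (realises : Realises n r s t w) where
    open Realises realises
    open Weights w

    Lmat-row : ∀ {a b} → a ≤ n → b ≤ suc n →
               Lmat r s t (suc (n ∸ a)) (suc n ∸ b) ≈ GF n w a b
    Lmat-row {a} {b} a≤n b≤1+n with b ≟ a
    ... | yes refl = begin
      Lmat r s t (suc (n ∸ a)) (suc n ∸ a)  ≡⟨ Lmat-diag r s t (+-∸-assoc 1 a≤n) ⟩
      r (n ∸ a)                             ≈⟨ diagonal a≤n ⟨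
      h1 a * h2 a                           ≈⟨ GF-diag n w a≤n ⟨
      GF n w a a                            ∎
    ... | no b≢a with b ≟ suc a
    ... | yes refl = begin
      Lmat r s t (suc (n ∸ a)) (n ∸ a)      ≡⟨ Lmat-sub r s t refl ⟩
      s (n ∸ a)                             ≈⟨ subdiagonal a≤n ⟨
      h1 a * d2 a + d1 a * h2 (suc a) + sd a ≈⟨ GF-super n w a≤n ⟨
      GF n w a (suc a)                      ∎
    ... | no b≢1+a with b ≟ suc (suc a)
    ... | yes refl = begin
      Lmat r s t (suc (n ∸ a)) (n ∸ suc a)  ≡⟨ Lmat-subsub r s t (sym (m∸n≡1+[m∸1+n] 1+a≤n)) ⟩
      tc t (n ∸ a)                          ≈⟨ subsubdiagonal 1+a≤n ⟨
      d1 a * d2 (suc a)                     ≈⟨ GF-super² n w a≤n ⟨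
      GF n w a (suc (suc a))                ∎
      where
      1+a≤n : suc a ≤ n
      1+a≤n = s≤s⁻¹ b≤1+n
    ... | no b≢2+a = begin
      Lmat r s t (suc (n ∸ a)) (suc n ∸ b)  ≡⟨ Lmat-zero r s t j≢1+i j≢i 1+j≢i ⟩
      0#                                    ≈⟨ GF-far n w a≤n b≢a b≢1+a b≢2+a ⟨
      GF n w a b                            ∎
      where
      j≢1+i : suc n ∸ b ≢ suc (n ∸ a)
      j≢1+i e = b≢a (∸-cancelˡ-≡ b≤1+n (m≤n⇒m≤1+n a≤n)
                                 (trans e (sym (+-∸-assoc 1 a≤n))))
      j≢i : suc n ∸ b ≢ n ∸ a
      j≢i e = b≢1+a (∸-cancelˡ-≡ b≤1+n (s≤s a≤n) e)
      1+j≢i : suc (suc n ∸ b) ≢ n ∸ a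
      1+j≢i e = b≢2+a (∸-cancelˡ-≡ (m≤n⇒m≤1+n b≤1+n) (s≤s (s≤s a≤n))
                                   (trans (+-∸-assoc 1 b≤1+n) e))

    Lmat-top-row : ∀ {b} → b ≤ suc n → Lmat r s t 0 (suc n ∸ b) ≈ GF n w (suc n) b
    Lmat-top-row b≤1+n with m≤n⇒m<n∨m≡n b≤1+n
    ... | inj₁ (s≤s b≤n) =
      ≈-trans (reflexive (cong (Lmat r s t 0) (+-∸-assoc 1 b≤n))) (≈-sym (GF-top-far n w b≤n))
    ... | inj₂ refl =
      ≈-trans (reflexive (cong (Lmat r s t 0) (n∸n≡0 n)))
              (≈-sym (≈-trans (GF-top-diag n w) top-corner))

    Lmat≈GF : ∀ {a b} → a ≤ suc n → b ≤ suc n →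
              Lmat r s t (suc n ∸ a) (suc n ∸ b) ≈ GF n w a b
    Lmat≈GF {b = b} a≤1+n b≤1+n with m≤n⇒m<n∨m≡n a≤1+n
    ... | inj₁ (s≤s a≤n) =
      ≈-trans (reflexive (cong (λ i → Lmat r s t i (suc n ∸ b)) (+-∸-assoc 1 a≤n)))
              (Lmat-row a≤n b≤1+n)
    ... | inj₂ refl =
      ≈-trans (reflexive (cong (λ i → Lmat r s t i (suc n ∸ b)) (n∸n≡0 n)))
              (Lmat-top-row b≤1+n)

  module _ (n : ℕ) (r s t : ℕ → Carrier) where
    open Realises

    type1-realises : Realises n r s t (weights n r s t type1)
    type1-realises .top-corner rewrite >⇒≤ᵇ≡false (n<1+n n) = *-identityʳ 1#
    type1-realises .diagonal a≤n rewrite ≤⇒≤ᵇ≡true a≤n = *-identityʳ _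
    type1-realises .subdiagonal a≤n rewrite ≤⇒≤ᵇ≡true a≤n =
      ≈-trans (+-congʳ (+-cong (*-identityʳ _) (*-identityʳ _))) (x+y+[s-x-y]≈s _ _ _)
    type1-realises .subsubdiagonal a<n rewrite ≤⇒≤ᵇ≡true (<⇒≤ a<n) = *-identityʳ _

    type2-realises : Realises n r s t (weights n r s t type2)
    type2-realises .top-corner rewrite >⇒≤ᵇ≡false (n<1+n n) = *-identityˡ 1#
    type2-realises .diagonal a≤n rewrite ≤⇒≤ᵇ≡true a≤n = *-identityˡ _
    type2-realises .subdiagonal a≤n with m≤n⇒m<n∨m≡n a≤n
    ... | inj₁ a<n
      rewrite ≤⇒≤ᵇ≡true a≤n | ≢⇒≡ᵇ≡false (<⇒≢ a<n) | ≤⇒≤ᵇ≡true a<n | m∸n≡1+[m∸1+n] a<n =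
      ≈-trans (+-congʳ (+-cong (*-identityˡ _) (*-identityˡ _))) (x+y+[s-y-x]≈s _ _ _)
    ... | inj₂ refl
      rewrite ≤⇒≤ᵇ≡true a≤n | ≡ᵇ-refl n | >⇒≤ᵇ≡false (n<1+n n) | n∸n≡0 n =
      ≈-trans (+-congʳ (+-cong (*-identityˡ _) (zeroˡ _))) (x+y+[s-y-x]≈s _ _ _)
    type2-realises .subsubdiagonal a<n
      rewrite ≢⇒≡ᵇ≡false (<⇒≢ a<n) | ≤⇒≤ᵇ≡true a<n | m∸n≡1+[m∸1+n] a<n = *-identityˡ _

    type3-realises : Realises n r s t (weights n r s t type3)
    type3-realises .top-corner rewrite >⇒≤ᵇ≡false (n<1+n n) = *-identityˡ 1#
    type3-realises .diagonal a≤n rewrite ≤⇒≤ᵇ≡true a≤n = *-identityˡ _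
    type3-realises .subdiagonal a≤n with m≤n⇒m<n∨m≡n a≤n
    ... | inj₁ a<n rewrite ≤⇒≤ᵇ≡true a≤n | ≤⇒≤ᵇ≡true a<n | m∸n≡1+[m∸1+n] a<n =
      ≈-trans (+-congʳ (+-cong (*-identityˡ 1#) (*-comm _ _))) (x+y+[s-y-x]≈s _ _ _)
    ... | inj₂ refl rewrite ≤⇒≤ᵇ≡true a≤n | >⇒≤ᵇ≡false (n<1+n n) | n∸n≡0 n =
      ≈-trans (+-cong (+-cong (*-identityˡ 1#) (zeroˡ 1#)) (+-congʳ (+-congˡ (-‿cong (zeroˡ 0#)))))
              (x+y+[s-y-x]≈s _ _ _)
    type3-realises .subsubdiagonal a<n rewrite ≤⇒≤ᵇ≡true (<⇒≤ a<n) = *-identityʳ _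

    type4-realises : Realises n r s t (weights n r s t type4)
    type4-realises .top-corner rewrite >⇒≤ᵇ≡false (n<1+n n) = *-identityʳ 1#
    type4-realises .diagonal a≤n rewrite ≤⇒≤ᵇ≡true a≤n = *-identityʳ _
    type4-realises .subdiagonal a≤n with m≤n⇒m<n∨m≡n a≤n
    ... | inj₁ a<n rewrite ≤⇒≤ᵇ≡true a≤n | ≢⇒≡ᵇ≡false (<⇒≢ a<n) | <⇒<ᵇ≡true a<n =
      ≈-trans (+-congʳ (+-congˡ (*-identityˡ 1#))) (x+y+[s-x-y]≈s _ _ _)
    ... | inj₂ refl rewrite ≤⇒≤ᵇ≡true a≤n | ≡ᵇ-refl n | <ᵇ-irrefl n | n∸n≡0 n =
      ≈-trans (+-congʳ (≈-trans (+-congˡ (zeroˡ 1#)) (+-identityʳ _))) (x+[s-x]≈s _ _)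
    type4-realises .subsubdiagonal a<n
      rewrite ≢⇒≡ᵇ≡false (<⇒≢ a<n) | ≤⇒≤ᵇ≡true a<n | m∸n≡1+[m∸1+n] a<n = *-identityˡ _

    module _ (b c′ : ℕ → Carrier) (r≈1 : ∀ k → r k ≈ 1#) (s≈b+c′ : ∀ k → s k ≈ b k + c′ k)
             (t≈b*c′ : ∀ k → t (suc k) ≈ b (suc k) * c′ k) where

      type5-realises : Realises n r s t (weights n r s t (type5 b c′ r≈1 s≈b+c′ t≈b*c′))
      type5-realises .top-corner = *-identityˡ 1#
      type5-realises .diagonal {a} _ = ≈-trans (*-identityˡ 1#) (≈-sym (r≈1 (n ∸ a)))
      type5-realises .subdiagonal {a} a≤n rewrite ≤⇒≤ᵇ≡true a≤n = begin
        1# * c′ (n ∸ a) + b (n ∸ a) * 1# + 0#  ≈⟨ +-identityʳ _ ⟩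
        1# * c′ (n ∸ a) + b (n ∸ a) * 1#       ≈⟨ +-cong (*-identityˡ _) (*-identityʳ _) ⟩
        c′ (n ∸ a) + b (n ∸ a)                 ≈⟨ +-comm _ _ ⟩
        b (n ∸ a) + c′ (n ∸ a)                 ≈⟨ s≈b+c′ (n ∸ a) ⟨
        s (n ∸ a)                              ∎
      type5-realises .subsubdiagonal a<n
        rewrite ≤⇒≤ᵇ≡true (<⇒≤ a<n) | ≤⇒≤ᵇ≡true a<n | m∸n≡1+[m∸1+n] a<n = ≈-sym (t≈b*c′ _)

    weights-realise : ∀ τ → Realises n r s t (weights n r s t τ)
    weights-realise type1 = type1-realises
    weights-realise type2 = type2-realises
    weights-realise type3 = type3-realises
    weights-realise type4 = type4-realises
    weights-realise (type5 b c′ r≈1 s≈b+c′ t≈b*c′) = type5-realises b c′ r≈1 s≈b+c′ t≈b*c′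

proposition2p2 : ∀ {c ℓ : Level} (R : CommutativeRing c ℓ) →
    let open CommutativeRing R in
    let open Setup R in
    (n : ℕ) (r s t : ℕ → Carrier) (τ : WeightType r s t) (i j : Fin (suc (suc n))) →
    Lmat r s t (toℕ i) (toℕ j) ≈ GF n (weights n r s t τ) (suc n ∸ toℕ i) (suc n ∸ toℕ j)
proposition2p2 R n r s t τ i j =
  subst₂ (λ i′ j′ → Lmat r s t i′ j′ ≈ GF n w (suc n ∸ toℕ i) (suc n ∸ toℕ j))
         (m∸[m∸n]≡n (toℕ≤pred[n] i)) (m∸[m∸n]≡n (toℕ≤pred[n] j))
         (Lmat≈GF R (weights-realise R n r s t τ)
                  (m∸n≤m (suc n) (toℕ i)) (m∸n≤m (suc n) (toℕ j)))
  where
  open CommutativeRing R using (_≈_)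
  open Setup R using (Weights; Lmat; GF; weights)
  w : Weights
  w = weights n r s t τ
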